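{- Let $A$ be an $n\times n$ irreducible stochastic matrix whose digraph is periodic of period $t\ge2$ with periodic partition $\{P_1,\ldots,P_t\}$. Then every solution $X\in\mathrm{Sym}(\mathcal V)$ of $AXA^*=X$ is a linear combination $\sum_{\delta\ge0}c_\delta X^{(\delta)}$ with nonnegative coefficients $c_\delta$.
   Context: $\mathcal V=\mathbb R^n$ and $\mathrm{Sym}(\mathcal V)$ is the cone of $n\times n$ real symmetric matrices with nonnegative entries; $A^*$ is the transpose. The digraph of $A$ has vertices $\{1,\ldots,n\}$ and an edge $i\to j$ iff $A_{ij}>0$; it is periodic of period $t\ge2$ with periodic partition $\{P_1,\ldots,P_t\}$ if every edge from $P_k$ ends in $P_{k+1}$ (indices mod $t$) and $t$ is the largest integer for which such a partition exists. For $i\in P_{s_1}$, $j\in P_{s_2}$, $\operatorname{dist}(i,j)=\min\{|s_1-s_2|,\ t-|s_1-s_2|\}$. For $\delta\ge0$, $X^{(\delta)}$ is the 0-1 matrix with $X^{(\delta)}_{ij}=1$ iff $\operatorname{dist}(i,j)=\delta$; the sum runs over the attained values $0\le\delta\le\lfloor t/2\rfloor$. -}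

module Defs where

open import Level using (Level)
open import Data.Nat as ℕ using (ℕ; zero; _⊓_; ∣_-_∣; _/_; _∸_)
open import Data.Fin using (Fin; zero; suc; toℕ)
open import Data.Product using (Σ; ∃; _×_; _,_)
open import Data.Sum using (_⊎_)
open import Relation.Binary.PropositionalEquality using (_≡_)
open import Relation.Nullary using (¬_)

-- An axiomatic real number field: a Dedekind-complete ordered field
-- (propositional equality on the carrier).  Classically every such
-- structure is isomorphic to ℝ; stdlib has no reals, so the theorem is
-- stated for an arbitrary model of these axioms.

record RealField (ℓ : Level) : Set (Level.suc ℓ) where
  infixl 6 _+_
  infixl 7 _*_
  infix  4 _<_ _≤_
  field
    ℝ    : Set ℓ
    0ℝ 1ℝ : ℝ
    _+_ _*_ : ℝ → ℝ → ℝ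
    -_   : ℝ → ℝ
    inv  : (x : ℝ) → ¬ (x ≡ 0ℝ) → ℝ
    _<_  : ℝ → ℝ → Set ℓ
    +-assoc : ∀ x y z → (x + y) + z ≡ x + (y + z)
    +-comm  : ∀ x y → x + y ≡ y + x
    +-identityˡ : ∀ x → 0ℝ + x ≡ x
    +-inverseˡ  : ∀ x → (- x) + x ≡ 0ℝ
    *-assoc : ∀ x y z → (x * y) * z ≡ x * (y * z)
    *-comm  : ∀ x y → x * y ≡ y * x
    *-identityˡ : ∀ x → 1ℝ * x ≡ x
    *-inverseˡ  : ∀ x (x≢0 : ¬ (x ≡ 0ℝ)) → inv x x≢0 * x ≡ 1ℝ
    distribˡ : ∀ x y z → x * (y + z) ≡ x * y + x * z
    0≢1 : ¬ (0ℝ ≡ 1ℝ)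
    <-irrefl : ∀ x → ¬ (x < x)
    <-trans  : ∀ x y z → x < y → y < z → x < z
    <-trichotomy : ∀ x y → (x < y) ⊎ (x ≡ y) ⊎ (y < x)
    +-mono-< : ∀ x y z → x < y → x + z < y + z
    *-pos    : ∀ x y → 0ℝ < x → 0ℝ < y → 0ℝ < x * y
    sup : (S : ℝ → Set ℓ) → (∃ λ x → S x) → (∃ λ b → ∀ x → S x → ¬ (b < x)) →
          ∃ λ s → (∀ x → S x → ¬ (s < x)) × (∀ b → (∀ x → S x → ¬ (b < x)) → ¬ (b < s))

  _≤_ : ℝ → ℝ → Set ℓ
  x ≤ y = ¬ (y < x)

module Matrices {ℓ : Level} (R : RealField ℓ) where
  open RealField R public

  Matrix : ℕ → Set ℓ
  Matrix n = Fin n → Fin n → ℝ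

  ∑ : ∀ {n} → (Fin n → ℝ) → ℝ
  ∑ {zero}    f = 0ℝ
  ∑ {ℕ.suc n} f = f zero + ∑ (λ i → f (suc i))

  _·_ : ∀ {n} → Matrix n → Matrix n → Matrix n
  (A · B) i j = ∑ λ k → A i k * B k j

  _ᵀ : ∀ {n} → Matrix n → Matrix n
  (A ᵀ) i j = A j i

  _⊙_ : ∀ {n} → ℝ → Matrix n → Matrix n
  (c ⊙ A) i j = c * A i j

  _⊕_ : ∀ {n} → Matrix n → Matrix n → Matrix n
  (A ⊕ B) i j = A i j + B i j

  𝟎 : ∀ {n} → Matrix n
  𝟎 i j = 0ℝ

  ∑M : ∀ {n m} → (Fin m → Matrix n) → Matrix n
  ∑M {m = zero}    F = 𝟎
  ∑M {m = ℕ.suc m} F = F zero ⊕ ∑M (λ δ → F (suc δ))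

  Nonneg : ∀ {n} → Matrix n → Set ℓ
  Nonneg A = ∀ i j → 0ℝ ≤ A i j

  Stochastic : ∀ {n} → Matrix n → Set ℓ
  Stochastic A = Nonneg A × (∀ i → ∑ (λ j → A i j) ≡ 1ℝ)

  InSym : ∀ {n} → Matrix n → Set ℓ
  InSym X = Nonneg X × (∀ i j → X i j ≡ X j i)

  Edge : ∀ {n} → Matrix n → Fin n → Fin n → Set ℓ
  Edge A i j = 0ℝ < A i j

  data Path {n} (A : Matrix n) : Fin n → Fin n → Set ℓ where
    step : ∀ {i j} → Edge A i j → Path A i j
    _∷_  : ∀ {i j k} → Edge A i j → Path A j k → Path A i k

  Irreducible : ∀ {n} → Matrix n → Set ℓ
  Irreducible A = ∀ i j → Path A i j

  -- a periodic partition {P_0,…,P_{t-1}} encoded by the class map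
  -- p : Fin n → ℕ (i ∈ P_{p i}); blocks nonempty; every edge from
  -- P_k ends in P_{k+1 mod t}
  IsPeriodicPartition : ∀ {n} → Matrix n → (t : ℕ) → (Fin n → ℕ) → Set ℓ
  IsPeriodicPartition A t p =
      (∀ i → p i ℕ.< t)
    × (∀ s → s ℕ.< t → ∃ λ i → p i ≡ s)
    × (∀ i j → Edge A i j →
         (ℕ.suc (p i) ℕ.< t × p j ≡ ℕ.suc (p i))
         ⊎ (ℕ.suc (p i) ≡ t × p j ≡ 0))

  -- digraph periodic of period t ≥ 2 with periodic partition p:
  -- t is the largest integer admitting a periodic partition
  PeriodicWith : ∀ {n} → Matrix n → (t : ℕ) → (Fin n → ℕ) → Set ℓ
  PeriodicWith {n} A t p =
      2 ℕ.≤ t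
    × IsPeriodicPartition A t p
    × (∀ t′ (p′ : Fin n → ℕ) → IsPeriodicPartition A t′ p′ → t′ ℕ.≤ t)

  dist : ∀ {n} → ℕ → (Fin n → ℕ) → Fin n → Fin n → ℕ
  dist t p i j = ∣ p i - p j ∣ ⊓ (t ∸ ∣ p i - p j ∣)

  Xδ : ∀ {n} → ℕ → (Fin n → ℕ) → ℕ → Matrix n
  Xδ t p δ i j with dist t p i j ℕ.≟ δ
  ... | Relation.Nullary.yes _ = 1ℝ
  ... | Relation.Nullary.no  _ = 0ℝ

module Submission where

open import Defs
open import Level using (Level)
open import Data.Nat using (ℕ; _/_; suc)
open import Data.Fin using (Fin; toℕ)
open import Data.Product using (Σ; ∃; _×_; _,_)
open import Relation.Binary.PropositionalEquality using (_≡_)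

-- (1) Maximum principle (module Harmonic).  (A X Aᵀ) i j is an average of
--     the X k l over edges i → k, j → l.  So if (m₁, m₂) maximises X on a set
--     S of pairs closed under such simultaneous steps, X keeps the value
--     X m₁ m₂ at the ends of any two walks of equal length from m₁ and m₂.
-- (2) Walk lengths (module Periodic).  Because t is the LARGEST period, a
--     Euclid-style descent on the gap between two closed walks at a base
--     vertex yields closed walks of lengths q t and (q + 1) t.  Hence every
--     large multiple of t is a closed-walk length (module Combination), and
--     pairs (i′, j′), (i, j) with p j′ - p i′ ≡ p j - p i (mod t) are joined
--     by walks i′ → i, j′ → j of a common length.
-- (3) Conclusion (module Theorem).  Applying (1) and (2) to a residue class S
--     of pairs, X i j depends only on p j - p i mod t, hence by symmetry only
--     on dist(i, j).  The coefficients are entries of X, hence nonnegative,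
--     and the expansion is checked entrywise (modules Expansion, Distance).

-- Elementary algebra and order in an ordered field

module OrderedField {ℓ : Level} (R : RealField ℓ) where
  open Matrices R
  open import Data.Nat as ℕ using (zero; suc)
  open import Data.Fin using (zero; suc)
  open import Data.Sum using (_⊎_; inj₁; inj₂)
  open import Data.Empty using (⊥-elim)
  open import Relation.Binary.PropositionalEquality
    using (refl; sym; trans; cong; cong₂; subst; subst₂; isEquivalence)
  open import Relation.Binary.Bundles using (TotalOrder)
  open import Relation.Nullary using (¬_)
  open import Function using (_∘_)
  open import Data.Fin.Properties using (suc-injective)
  open Relation.Binary.PropositionalEquality.≡-Reasoning

  +-identityʳ : ∀ x → x + 0ℝ ≡ x
  +-identityʳ x = trans (+-comm x 0ℝ) (+-identityˡ x)

  +-inverseʳ : ∀ x → x + (- x) ≡ 0ℝ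
  +-inverseʳ x = trans (+-comm x (- x)) (+-inverseˡ x)

  *-identityʳ : ∀ x → x * 1ℝ ≡ x
  *-identityʳ x = trans (*-comm x 1ℝ) (*-identityˡ x)

  distribʳ : ∀ x y z → (y + z) * x ≡ y * x + z * x
  distribʳ x y z = begin
    (y + z) * x     ≡⟨ *-comm (y + z) x ⟩
    x * (y + z)     ≡⟨ distribˡ x y z ⟩
    x * y + x * z   ≡⟨ cong₂ _+_ (*-comm x y) (*-comm x z) ⟩
    y * x + z * x   ∎

  +-cancelˡ : ∀ a {x y} → a + x ≡ a + y → x ≡ y
  +-cancelˡ a {x} {y} eq = begin
    x                 ≡⟨ sym (+-identityˡ x) ⟩
    0ℝ + x            ≡⟨ cong (_+ x) (sym (+-inverseˡ a)) ⟩
    ((- a) + a) + x   ≡⟨ +-assoc (- a) a x ⟩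
    (- a) + (a + x)   ≡⟨ cong ((- a) +_) eq ⟩
    (- a) + (a + y)   ≡⟨ sym (+-assoc (- a) a y) ⟩
    ((- a) + a) + y   ≡⟨ cong (_+ y) (+-inverseˡ a) ⟩
    0ℝ + y            ≡⟨ +-identityˡ y ⟩
    y                 ∎

  *-zeroʳ : ∀ x → x * 0ℝ ≡ 0ℝ
  *-zeroʳ x = +-cancelˡ (x * 0ℝ) (begin
    x * 0ℝ + x * 0ℝ   ≡⟨ sym (distribˡ x 0ℝ 0ℝ) ⟩
    x * (0ℝ + 0ℝ)     ≡⟨ cong (x *_) (+-identityˡ 0ℝ) ⟩
    x * 0ℝ            ≡⟨ sym (+-identityʳ _) ⟩
    x * 0ℝ + 0ℝ       ∎)

  *-zeroˡ : ∀ x → 0ℝ * x ≡ 0ℝ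
  *-zeroˡ x = trans (*-comm 0ℝ x) (*-zeroʳ x)

  *-negateʳ : ∀ a x → a * (- x) ≡ - (a * x)
  *-negateʳ a x = +-cancelˡ (a * x) (begin
    a * x + a * (- x)   ≡⟨ sym (distribˡ a x (- x)) ⟩
    a * (x + - x)       ≡⟨ cong (a *_) (+-inverseʳ x) ⟩
    a * 0ℝ              ≡⟨ *-zeroʳ a ⟩
    0ℝ                  ≡⟨ sym (+-inverseʳ (a * x)) ⟩
    a * x + - (a * x)   ∎)

  -- x ≼ y is the positive (disjunctive) form of x ≤ y = ¬ (y < x); the
  -- two agree by trichotomy, and ≼ is a total order.
  infix 4 _≼_
  _≼_ : ℝ → ℝ → Set ℓ
  x ≼ y = (x < y) ⊎ (x ≡ y)

  ≤⇒≼ : ∀ {x y} → x ≤ y → x ≼ y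
  ≤⇒≼ {x} {y} x≤y with <-trichotomy x y
  ... | inj₁ x<y        = inj₁ x<y
  ... | inj₂ (inj₁ x≡y) = inj₂ x≡y
  ... | inj₂ (inj₂ y<x) = ⊥-elim (x≤y y<x)

  <-≼-trans : ∀ {x y z} → x < y → y ≼ z → x < z
  <-≼-trans {x} {y} {z} x<y (inj₁ y<z) = <-trans x y z x<y y<z
  <-≼-trans x<y (inj₂ refl) = x<y

  ≼-trans : ∀ {x y z} → x ≼ y → y ≼ z → x ≼ z
  ≼-trans (inj₁ x<y) y≼z  = inj₁ (<-≼-trans x<y y≼z)
  ≼-trans (inj₂ refl) y≼z = y≼z

  ≼-total : ∀ x y → (x ≼ y) ⊎ (y ≼ x)
  ≼-total x y with <-trichotomy x y
  ... | inj₁ x<y        = inj₁ (inj₁ x<y)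
  ... | inj₂ (inj₁ x≡y) = inj₁ (inj₂ x≡y)
  ... | inj₂ (inj₂ y<x) = inj₂ (inj₁ y<x)

  ≼-antisym : ∀ {x y} → x ≼ y → y ≼ x → x ≡ y
  ≼-antisym (inj₂ x≡y) _          = x≡y
  ≼-antisym (inj₁ x<y) (inj₂ y≡x) = sym y≡x
  ≼-antisym {x} {y} (inj₁ x<y) (inj₁ y<x) = ⊥-elim (<-irrefl x (<-trans x y x x<y y<x))

  -- The bundle needed to take maxima of finite lists (Data.List.Extrema).
  ≼-totalOrder : TotalOrder ℓ ℓ ℓ
  ≼-totalOrder = record
    { Carrier = ℝ
    ; _≈_ = _≡_
    ; _≤_ = _≼_
    ; isTotalOrder = record
      { isPartialOrder = record
        { isPreorder = record
          { isEquivalence = isEquivalence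
          ; reflexive = inj₂
          ; trans = ≼-trans
          }
        ; antisym = ≼-antisym
        }
      ; total = ≼-total
      }
    }

  +-monoʳ-< : ∀ x {y z} → y < z → x + y < x + z
  +-monoʳ-< x {y} {z} y<z = subst₂ _<_ (+-comm y x) (+-comm z x) (+-mono-< y z x y<z)

  +-mono-<-≼ : ∀ {a b c d} → a < b → c ≼ d → a + c < b + d
  +-mono-<-≼ {a} {b} {c} {d} a<b (inj₁ c<d) =
    <-trans _ _ _ (+-mono-< a b c a<b) (+-monoʳ-< b c<d)
  +-mono-<-≼ {a} {b} {c} a<b (inj₂ refl) = +-mono-< a b c a<b

  +-mono-≼ : ∀ {a b c d} → a ≼ b → c ≼ d → a + c ≼ b + d
  +-mono-≼ (inj₁ a<b) c≼d = inj₁ (+-mono-<-≼ a<b c≼d)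
  +-mono-≼ {a} (inj₂ refl) (inj₁ c<d) = inj₁ (+-monoʳ-< a c<d)
  +-mono-≼ (inj₂ refl) (inj₂ refl) = inj₂ refl

  -- Multiplication by a positive element is strictly monotone:
  -- a y - a x = a (y - x) is a product of positives.
  *-monoˡ-< : ∀ {a x y} → 0ℝ < a → x < y → a * x < a * y
  *-monoˡ-< {a} {x} {y} 0<a x<y =
    subst₂ _<_ (+-identityˡ (a * x)) cancel (+-mono-< _ _ (a * x) 0<a[y-x])
    where
    0<y-x : 0ℝ < y + - x
    0<y-x = subst (_< y + - x) (+-inverseʳ x) (+-mono-< x y (- x) x<y)
    0<a[y-x] : 0ℝ < a * y + - (a * x)
    0<a[y-x] = subst (0ℝ <_) (trans (distribˡ a y (- x)) (cong (a * y +_) (*-negateʳ a x)))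
                     (*-pos a (y + - x) 0<a 0<y-x)
    cancel : a * y + - (a * x) + a * x ≡ a * y
    cancel = trans (+-assoc _ _ _) (trans (cong (a * y +_) (+-inverseˡ (a * x))) (+-identityʳ _))

  -- Multiplication by a nonnegative weight a preserves x ≼ y, where the
  -- comparison is only needed when the weight is positive.
  *-monoˡ-≼ : ∀ {a x y} → 0ℝ ≼ a → (0ℝ < a → x ≼ y) → a * x ≼ a * y
  *-monoˡ-≼ (inj₁ 0<a) x≼y with x≼y 0<a
  ... | inj₁ x<y  = inj₁ (*-monoˡ-< 0<a x<y)
  ... | inj₂ refl = inj₂ refl
  *-monoˡ-≼ {x = x} {y} (inj₂ refl) _ = inj₂ (trans (*-zeroˡ x) (sym (*-zeroˡ y)))

  ∑-cong : ∀ {k} {f g : Fin k → ℝ} → (∀ i → f i ≡ g i) → ∑ f ≡ ∑ g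
  ∑-cong {zero}  f≡g = refl
  ∑-cong {suc k} f≡g = cong₂ _+_ (f≡g zero) (∑-cong (λ i → f≡g (suc i)))

  ∑-mono-≼ : ∀ {k} (f g : Fin k → ℝ) → (∀ i → f i ≼ g i) → ∑ f ≼ ∑ g
  ∑-mono-≼ {zero}  f g f≼g = inj₂ refl
  ∑-mono-≼ {suc k} f g f≼g =
    +-mono-≼ (f≼g zero) (∑-mono-≼ (λ i → f (suc i)) (λ i → g (suc i)) (λ i → f≼g (suc i)))

  ∑-mono-< : ∀ {k} (f g : Fin k → ℝ) → (∀ i → f i ≼ g i) → ∀ i₀ → f i₀ < g i₀ → ∑ f < ∑ g
  ∑-mono-< {suc k} f g f≼g zero f<g =
    +-mono-<-≼ f<g (∑-mono-≼ (λ i → f (suc i)) (λ i → g (suc i)) (λ i → f≼g (suc i)))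
  ∑-mono-< {suc k} f g f≼g (suc i₀) f<g = subst₂ _<_ (+-comm _ _) (+-comm _ _)
    (+-mono-<-≼ (∑-mono-< (λ i → f (suc i)) (λ i → g (suc i)) (λ i → f≼g (suc i)) i₀ f<g)
                (f≼g zero))

  ∑-zero : ∀ {k} (f : Fin k → ℝ) → (∀ i → f i ≡ 0ℝ) → ∑ f ≡ 0ℝ
  ∑-zero {zero}  f f≡0 = refl
  ∑-zero {suc k} f f≡0 =
    trans (cong₂ _+_ (f≡0 zero) (∑-zero (λ i → f (suc i)) (λ i → f≡0 (suc i)))) (+-identityˡ 0ℝ)

  ∑-single : ∀ {k} (f : Fin k → ℝ) (i₀ : Fin k) → (∀ i → ¬ (i ≡ i₀) → f i ≡ 0ℝ) → ∑ f ≡ f i₀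
  ∑-single {suc k} f zero f≡0 =
    trans (cong (f zero +_) (∑-zero _ (λ i → f≡0 (suc i) (λ ())))) (+-identityʳ _)
  ∑-single {suc k} f (suc i₀) f≡0 = trans
    (cong₂ _+_ (f≡0 zero (λ ())) (∑-single (λ i → f (suc i)) i₀ (λ i i≢i₀ → f≡0 (suc i) (i≢i₀ ∘ suc-injective))))
    (+-identityˡ _)

  ∑-*ʳ : ∀ {k} (f : Fin k → ℝ) c → ∑ (λ i → f i * c) ≡ ∑ f * c
  ∑-*ʳ {zero}  f c = sym (*-zeroˡ c)
  ∑-*ʳ {suc k} f c = trans (cong (f zero * c +_) (∑-*ʳ (λ i → f (suc i)) c)) (sym (distribʳ c _ _))

  module _ {k} (w f : Fin k → ℝ) (M : ℝ) (w≥0 : ∀ i → 0ℝ ≼ w i) (∑w≡1 : ∑ w ≡ 1ℝ)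
           (f≼M : ∀ i → 0ℝ < w i → f i ≼ M) where

    private
      termwise : ∀ i → w i * f i ≼ w i * M
      termwise i = *-monoˡ-≼ (w≥0 i) (f≼M i)

      average-of-M : ∑ (λ i → w i * M) ≡ M
      average-of-M = trans (∑-*ʳ w M) (trans (cong (_* M) ∑w≡1) (*-identityˡ M))

    average-≼ : ∑ (λ i → w i * f i) ≼ M
    average-≼ = subst (_ ≼_) average-of-M (∑-mono-≼ _ _ termwise)

    average-< : ∀ i₀ → 0ℝ < w i₀ → f i₀ < M → ∑ (λ i → w i * f i) < M
    average-< i₀ 0<w f<M =
      subst (_ <_) average-of-M (∑-mono-< _ _ termwise i₀ (*-monoˡ-< 0<w f<M))

-- Congruence of natural numbers modulo a positive g

module Mod (g : ℕ) .{{_ : Data.Nat.NonZero g}} where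
  open import Data.Nat as ℕ using (suc; _+_; _*_; _∸_; _%_; _<_; _≤_)
  open import Data.Nat.Properties
    using (+-comm; +-assoc; <⇒≤; m+[n∸m]≡n; <-cmp; <-irrefl; <-≤-trans; ≤-trans; m≤m*n; m≤m+n)
  open import Data.Nat.DivMod
    using (%-distribˡ-+; [m+kn]%n≡m%n; m%n%n≡m%n; m≡m%n+[m/n]*n; m%n<n; m<n⇒m%n≡m; n%n≡0)
  open import Data.Sum using (_⊎_; inj₁; inj₂)
  open import Data.Empty using (⊥-elim)
  open import Relation.Binary.PropositionalEquality
    using (refl; sym; trans; cong; subst₂)
  open import Relation.Binary.Definitions using (tri<; tri≈; tri>)
  open import Relation.Nullary using (Dec)
  open import Data.Nat.Tactic.RingSolver using (solve-∀)
  open Relation.Binary.PropositionalEquality.≡-Reasoning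

  infix 4 _≡ₘ_ _≡ₘ?_
  _≡ₘ_ : ℕ → ℕ → Set
  x ≡ₘ y = x % g ≡ y % g

  _≡ₘ?_ : ∀ x y → Dec (x ≡ₘ y)
  x ≡ₘ? y = x % g ℕ.≟ y % g

  ≡ₘ-+ʳ : ∀ {x y} z → x ≡ₘ y → x + z ≡ₘ y + z
  ≡ₘ-+ʳ {x} {y} z x≡y = begin
    (x + z) % g             ≡⟨ %-distribˡ-+ x z g ⟩
    (x % g + z % g) % g     ≡⟨ cong (λ u → (u + z % g) % g) x≡y ⟩
    (y % g + z % g) % g     ≡⟨ %-distribˡ-+ y z g ⟨
    (y + z) % g             ∎

  ≡ₘ-+ˡ : ∀ {x y} z → x ≡ₘ y → z + x ≡ₘ z + y
  ≡ₘ-+ˡ {x} {y} z x≡y = subst₂ _≡ₘ_ (+-comm x z) (+-comm y z) (≡ₘ-+ʳ z x≡y)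

  ≡ₘ-+ : ∀ {a b c d} → a ≡ₘ b → c ≡ₘ d → a + c ≡ₘ b + d
  ≡ₘ-+ {b = b} {c} a≡b c≡d = trans (≡ₘ-+ʳ c a≡b) (≡ₘ-+ˡ b c≡d)

  +-multiple : ∀ x k → x + k * g ≡ₘ x
  +-multiple x k = [m+kn]%n≡m%n x k g

  mod-≡ₘ : ∀ x → x % g ≡ₘ x
  mod-≡ₘ x = m%n%n≡m%n x g

  -- Cancellation: add w = g - z % g, which completes z to a multiple of g.
  ≡ₘ-cancelʳ : ∀ {x y} z → x + z ≡ₘ y + z → x ≡ₘ y
  ≡ₘ-cancelʳ {x} {y} z x+z≡y+z =
    trans (sym (completes x)) (trans (≡ₘ-+ʳ w x+z≡y+z) (completes y))
    where
    w : ℕ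
    w = g ∸ z % g
    regroup : ∀ a b c → a + b + c ≡ b + (a + c)
    regroup = solve-∀
    z+w : z + w ≡ suc (z ℕ./ g) * g
    z+w = begin
      z + w                          ≡⟨ cong (_+ w) (m≡m%n+[m/n]*n z g) ⟩
      z % g + z ℕ./ g * g + w        ≡⟨ regroup (z % g) (z ℕ./ g * g) w ⟩
      z ℕ./ g * g + (z % g + w)      ≡⟨ cong (z ℕ./ g * g +_) (m+[n∸m]≡n (<⇒≤ (m%n<n z g))) ⟩
      z ℕ./ g * g + g                ≡⟨ +-comm (z ℕ./ g * g) g ⟩
      suc (z ℕ./ g) * g              ∎
    completes : ∀ u → u + z + w ≡ₘ u
    completes u = trans (cong (_% g) (trans (+-assoc u z w) (cong (u +_) z+w)))
                        (+-multiple u (suc (z ℕ./ g)))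

  ≡ₘ-cancelˡ : ∀ {x y} z → z + x ≡ₘ z + y → x ≡ₘ y
  ≡ₘ-cancelˡ {x} {y} z eq = ≡ₘ-cancelʳ z (subst₂ _≡ₘ_ (+-comm z x) (+-comm z y) eq)

  zero-residue : 0 % g ≡ 0
  zero-residue = m<n⇒m%n≡m (ℕ.>-nonZero⁻¹ g)

  ≡ₘ0⇒multiple : ∀ {x} → x ≡ₘ 0 → x ≡ (x ℕ./ g) * g
  ≡ₘ0⇒multiple {x} x≡0 =
    trans (m≡m%n+[m/n]*n x g) (cong (_+ (x ℕ./ g) * g) (trans x≡0 zero-residue))

  <-≡ₘ⇒residue : ∀ {x y} → x < g → x ≡ₘ y → x ≡ y % g
  <-≡ₘ⇒residue x<g x≡y = trans (sym (m<n⇒m%n≡m x<g)) x≡y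

  suc-residue : ∀ {x y} → x + 1 ≡ₘ y → suc (x % g) ≡ₘ y
  suc-residue {x} x+1≡y = trans (cong (_% g) (+-comm 1 (x % g))) (trans (≡ₘ-+ʳ 1 (mod-≡ₘ x)) x+1≡y)

  -- If y ≡ x + 1 then the residue of y is the cyclic successor of the
  -- residue of x: this is the edge condition of a periodic partition.
  successor-residue : ∀ {x y} → x + 1 ≡ₘ y →
      (suc (x % g) < g × y % g ≡ suc (x % g)) ⊎ (suc (x % g) ≡ g × y % g ≡ 0)
  successor-residue {x} {y} x+1≡y with <-cmp (suc (x % g)) g
  ... | tri< r+1<g _ _ = inj₁ (r+1<g , sym (<-≡ₘ⇒residue r+1<g (suc-residue x+1≡y)))
  ... | tri≈ _ r+1≡g _ = inj₂ (r+1≡g , trans (sym (suc-residue x+1≡y)) (trans (cong (_% g) r+1≡g) (n%n≡0 g)))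
  ... | tri> _ _ r+1>g = ⊥-elim (<-irrefl refl (<-≤-trans r+1>g (m%n<n x g)))

  large-shift : ∀ {x} y N → x ≤ g → ∃ λ m → N ≤ m × x + m ≡ₘ y
  large-shift {x} y N x≤g = m , ≤-trans (m≤m*n N g) (m≤m+n (N * g) _) , x+m≡y
    where
    m : ℕ
    m = N * g + ((g ∸ x) + y)
    regroup : ∀ a b c d e → a + (b * c + (d + e)) ≡ e + ((a + d) + b * c)
    regroup = solve-∀
    x+m≡y : x + m ≡ₘ y
    x+m≡y = begin
      (x + m) % g                        ≡⟨ cong (_% g) (regroup x N g (g ∸ x) y) ⟩
      (y + ((x + (g ∸ x)) + N * g)) % g  ≡⟨ cong (λ u → (y + (u + N * g)) % g) (m+[n∸m]≡n x≤g) ⟩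
      (y + suc N * g) % g                ≡⟨ +-multiple y (suc N) ⟩
      y % g                              ∎

module Combination where
  open import Data.Nat using (_+_; _*_; _∸_; _%_; _≤_)
  open import Data.Nat.Properties
    using (*-identityʳ; *-suc; +-comm; +-assoc; *-distribʳ-+; m∸n+n≡m; <⇒≤; <-≤-trans)
  open import Data.Nat.DivMod using (m≡m%n+[m/n]*n; m%n<n; /-monoˡ-≤; m*n/n≡m)
  open import Relation.Binary.PropositionalEquality using (sym; trans; cong; subst)
  open Relation.Binary.PropositionalEquality.≡-Reasoning

  -- Write m = d a + r with r < a ≤ d; then m = (d - r) a + r (a + 1).
  consecutive-combination : ∀ a m → a * a ≤ m → ∃ λ x → ∃ λ y → x * a + y * suc a ≡ m
  consecutive-combination 0 m _ = 0 , m , *-identityʳ m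
  consecutive-combination a@(suc _) m a²≤m = d ∸ r , r , combination
    where
    d : ℕ
    d = m / a
    r : ℕ
    r = m % a
    r≤d : r ≤ d
    r≤d = <⇒≤ (<-≤-trans (m%n<n m a) (subst (_≤ d) (m*n/n≡m a a) (/-monoˡ-≤ a a²≤m)))
    combination : (d ∸ r) * a + r * suc a ≡ m
    combination = begin
      (d ∸ r) * a + r * suc a       ≡⟨ cong ((d ∸ r) * a +_) (trans (*-suc r a) (+-comm r (r * a))) ⟩
      (d ∸ r) * a + (r * a + r)     ≡⟨ sym (+-assoc ((d ∸ r) * a) (r * a) r) ⟩
      (d ∸ r) * a + r * a + r       ≡⟨ cong (_+ r) (sym (*-distribʳ-+ a (d ∸ r) r)) ⟩
      (d ∸ r + r) * a + r           ≡⟨ cong (λ u → u * a + r) (m∸n+n≡m r≤d) ⟩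
      d * a + r                     ≡⟨ +-comm (d * a) r ⟩
      r + d * a                     ≡⟨ sym (m≡m%n+[m/n]*n m a) ⟩
      m                             ∎

-- Walks of prescribed length in the digraph of a matrix

module Digraph {ℓ : Level} (R : RealField ℓ) {n : ℕ} (A : Matrices.Matrix R n) where
  open Matrices R using (Edge; Path; step; _∷_; 0ℝ; _<_; <-trichotomy; <-irrefl; <-trans)
  open import Data.Nat as ℕ using (zero; suc; _+_; _*_; _≤_; s≤s; NonZero)
  open import Data.Sum using (inj₁; inj₂)
  open import Relation.Binary.PropositionalEquality using (sym; subst)
  open import Relation.Nullary using (Dec; yes; no)

  infixr 5 _◅_
  data Walk : Fin n → Fin n → ℕ → Set ℓ where
    ε   : ∀ {a} → Walk a a 0
    _◅_ : ∀ {a b c k} → Edge A a b → Walk b c k → Walk a c (suc k)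

  infixr 5 _++ʷ_
  _++ʷ_ : ∀ {a b c k m} → Walk a b k → Walk b c m → Walk a c (k + m)
  ε       ++ʷ w = w
  (e ◅ u) ++ʷ w = e ◅ (u ++ʷ w)

  repeat : ∀ {a L} → Walk a a L → ∀ x → Walk a a (x * L)
  repeat w zero    = ε
  repeat w (suc x) = w ++ʷ repeat w x

  prefix : ∀ {a b L} → Walk a b L → ∀ s → s ≤ L → ∃ λ u → Walk a u s
  prefix w       zero    _         = _ , ε
  prefix (e ◅ w) (suc s) (s≤s s≤L) with prefix w s s≤L
  ... | u , w′ = u , e ◅ w′

  fromPath : ∀ {a b} → Path A a b → ∃ λ k → Walk a b (suc k)
  fromPath (step e) = 0 , e ◅ ε
  fromPath (e ∷ ps) with fromPath ps
  ... | k , w = suc k , e ◅ w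

  edge? : ∀ a b → Dec (Edge A a b)
  edge? a b with <-trichotomy 0ℝ (A a b)
  ... | inj₁ 0<A        = yes 0<A
  ... | inj₂ (inj₁ 0≡A) = no (λ 0<A → <-irrefl 0ℝ (subst (0ℝ <_) (sym 0≡A) 0<A))
  ... | inj₂ (inj₂ A<0) = no (λ 0<A → <-irrefl 0ℝ (<-trans _ _ _ 0<A A<0))

  module _ (g : ℕ) .{{_ : NonZero g}} (f : Fin n → ℕ) where
    open Mod g
    open import Relation.Binary.PropositionalEquality using (trans; cong)
    open import Data.Nat.Properties using (+-identityʳ; +-assoc)

    walk-potential : (∀ {a b} → Edge A a b → f a + 1 ≡ₘ f b) →
                     ∀ {a b k} → Walk a b k → f a + k ≡ₘ f b
    walk-potential edge-rule {a} ε = cong (ℕ._% g) (+-identityʳ (f a))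
    walk-potential edge-rule {a} (_◅_ {k = k} e w) =
      trans (cong (ℕ._% g) (sym (+-assoc (f a) 1 k)))
            (trans (≡ₘ-+ʳ k (edge-rule e)) (walk-potential edge-rule w))

-- The periodic digraph.  Closed walks at a base vertex whose lengths
-- differ by exactly t exist because t is the largest period; consequently
-- walks exist for every large length compatible with the classes.

module Periodic {ℓ : Level} (R : RealField ℓ) {n : ℕ} (A : Matrices.Matrix R n)
                {t : ℕ} {p : Fin n → ℕ} (irreducible : Matrices.Irreducible R A)
                (periodic : Matrices.PeriodicWith R A t p) where
  open Matrices R using (Edge; IsPeriodicPartition)
  open Digraph R A
  open Combination
  open import Data.Nat as ℕ using (suc; _+_; _*_; _∸_; _%_; _<_; _≤_; z≤n; s≤s; NonZero)
  open import Data.Nat.Properties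
    using (+-comm; +-assoc; ≤-trans; ≤-antisym; <⇒≤; <-≤-trans; m≤m+n; m≤n+m;
           m+[n∸m]≡n; +-cancelˡ-≤; *-cancelʳ-≤)
  open import Data.Nat.DivMod using (m≡m%n+[m/n]*n; m%n<n; n%n≡0; m/n≢0⇒n≤m)
  open import Data.Nat.Induction using (<-rec)
  open import Data.Nat.Tactic.RingSolver using (solve-∀)
  open import Data.Fin as Fin using ()
  open import Data.Fin.Properties using (all?; ¬∀⟶∃¬)
  open import Data.Product using (proj₁; proj₂)
  open import Data.Sum using (inj₁; inj₂)
  open import Data.Empty using (⊥-elim)
  open import Relation.Binary.PropositionalEquality
    using (refl; sym; trans; cong; cong₂; subst; subst₂)
  open import Relation.Nullary using (¬_; Dec; yes; no)
  open import Relation.Nullary.Decidable using (_→-dec_)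
  open Relation.Binary.PropositionalEquality.≡-Reasoning

  2≤t : 2 ≤ t
  2≤t = proj₁ periodic

  partition : IsPeriodicPartition A t p
  partition = proj₁ (proj₂ periodic)

  maximal : ∀ t′ p′ → IsPeriodicPartition A t′ p′ → t′ ≤ t
  maximal = proj₂ (proj₂ periodic)

  p<t : ∀ i → p i < t
  p<t = proj₁ partition

  0<t : 0 < t
  0<t = <-≤-trans (s≤s z≤n) 2≤t

  instance
    t≢0 : NonZero t
    t≢0 = ℕ.>-nonZero 0<t

  open Mod t

  edge-step : ∀ {a b} → Edge A a b → p a + 1 ≡ₘ p b
  edge-step {a} {b} e with proj₂ (proj₂ partition) a b e
  ... | inj₁ (_ , pb≡pa+1)  = cong (_% t) (trans (+-comm (p a) 1) (sym pb≡pa+1))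
  ... | inj₂ (pa+1≡t , pb≡0) = begin
    (p a + 1) % t   ≡⟨ cong (_% t) (trans (+-comm (p a) 1) pa+1≡t) ⟩
    t % t           ≡⟨ n%n≡0 t ⟩
    0               ≡⟨ sym zero-residue ⟩
    0 % t           ≡⟨ cong (_% t) (sym pb≡0) ⟩
    p b % t         ∎

  walk-step : ∀ {a b k} → Walk a b k → p a + k ≡ₘ p b
  walk-step = walk-potential t p edge-step

  reach : ∀ a b → ∃ λ k → Walk a b k
  reach a b = suc (proj₁ (fromPath (irreducible a b))) , proj₂ (fromPath (irreducible a b))

  base : Fin n
  base = proj₁ (proj₁ (proj₂ partition) 0 0<t)

  p-base : p base ≡ 0
  p-base = proj₂ (proj₁ (proj₂ partition) 0 0<t)

  Closed : ℕ → Set ℓ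
  Closed L = Walk base base L

  closed-≡ₘ0 : ∀ {L} → Closed L → L ≡ₘ 0
  closed-≡ₘ0 {L} w = subst₂ _≡ₘ_ (cong (_+ L) p-base) p-base (walk-step w)

  Gap : ℕ → Set ℓ
  Gap g = ∃ λ P → ∃ λ Q → Closed P × Closed Q × P ≡ Q + g

  -- Gaps are therefore multiples of t as well.
  period≤gap : ∀ {g} .{{_ : NonZero g}} → Gap g → t ≤ g
  period≤gap {g} (P , Q , wP , wQ , P≡Q+g) = m/n≢0⇒n≤m g/t≢0
    where
    g≡0 : g ≡ₘ 0
    g≡0 = ≡ₘ-cancelˡ Q (begin
      (Q + g) % t   ≡⟨ cong (_% t) P≡Q+g ⟨
      P % t         ≡⟨ closed-≡ₘ0 wP ⟩
      0 % t         ≡⟨ closed-≡ₘ0 wQ ⟨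
      Q % t         ≡⟨ cong (_% t) (+-comm 0 Q) ⟩
      (Q + 0) % t   ∎)
    g/t≢0 : ¬ (g ℕ./ t ≡ 0)
    g/t≢0 g/t≡0 = ℕ.≢-nonZero⁻¹ g (trans (≡ₘ0⇒multiple g≡0) (cong (_* t) g/t≡0))

  depthWalk : ∀ k → ∃ λ d → Walk base k d
  depthWalk k with k Fin.≟ base
  ... | yes refl = 0 , ε
  ... | no _     = reach base k

  depth : Fin n → ℕ
  depth k = proj₁ (depthWalk k)

  depth-base : depth base ≡ 0
  depth-base with base Fin.≟ base
  ... | yes refl = refl
  ... | no base≢base = ⊥-elim (base≢base refl)

  module Residue (g : ℕ) .{{_ : NonZero g}} where
    private module G = Mod g

    -- depth advances by one (mod g) along every edge, as a class map would.
    Consistent : Set ℓ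
    Consistent = ∀ a b → Edge A a b → depth a + 1 G.≡ₘ depth b

    consistent? : Dec Consistent
    consistent? = all? λ a → all? λ b → edge? a b →-dec (depth a + 1 G.≡ₘ? depth b)

    -- Consistent depths, reduced mod g, form a periodic partition with g
    -- classes; a closed walk of length ≥ g passes through all of them.
    consistent⇒partition : Consistent → ∀ {P} → Closed P → g ≤ P →
                           IsPeriodicPartition A g (λ k → depth k % g)
    consistent⇒partition consistent {P} wP g≤P =
      (λ k → m%n<n (depth k) g) , inhabited , λ a b e → G.successor-residue (consistent a b e)
      where
      inhabited : ∀ s → s < g → ∃ λ k → depth k % g ≡ s
      inhabited s s<g with prefix wP s (≤-trans (<⇒≤ s<g) g≤P)
      ... | u , w = u , sym (G.<-≡ₘ⇒residue s<g
                        (subst (λ d → d + s G.≡ₘ depth u) depth-base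
                               (walk-potential g depth (λ {a} {b} → consistent a b) w)))

    inconsistentEdge : ¬ Consistent → ∃ λ a → ∃ λ b → Edge A a b × ¬ (depth a + 1 G.≡ₘ depth b)
    inconsistentEdge ¬consistent
      with ¬∀⟶∃¬ n _ (λ a → all? λ b → edge? a b →-dec (depth a + 1 G.≡ₘ? depth b)) ¬consistent
    ... | a , ¬consistentₐ with ¬∀⟶∃¬ n _ (λ b → edge? a b →-dec (depth a + 1 G.≡ₘ? depth b)) ¬consistentₐ
    ... | b , ¬consistentₐᵦ with edge? a b
    ... | yes e  = a , b , e , λ ok → ¬consistentₐᵦ (λ _ → ok)
    ... | no ¬e  = ⊥-elim (¬consistentₐᵦ (λ e → ⊥-elim (¬e e)))

    -- For an inconsistent edge a → b and a walk b → base of length r, the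
    -- closed walks through a → b (length depth a + 1 + r) and from b
    -- (length depth b + r) cannot both have length ≡ 0 mod g.
    inconsistent⇒closedWalk : ¬ Consistent → ∃ λ L → Closed L × ¬ (L G.≡ₘ 0)
    inconsistent⇒closedWalk ¬consistent with inconsistentEdge ¬consistent
    ... | a , b , e , bad with reach b base
    ... | r , back with depth a + suc r G.≡ₘ? 0 | depth b + r G.≡ₘ? 0
    ... | no ≢0  | _      = _ , proj₂ (depthWalk a) ++ʷ e ◅ back , ≢0
    ... | yes _  | no ≢0  = _ , proj₂ (depthWalk b) ++ʷ back , ≢0
    ... | yes ≡0 | yes ≡0′ = ⊥-elim (bad (G.≡ₘ-cancelʳ r
          (trans (cong (_% g) (+-assoc (depth a) 1 r)) (trans ≡0 (sym ≡0′)))))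

  shrinkGap : ∀ {g} .{{_ : NonZero g}} → Gap g → ∀ {L} → Closed L → Gap (L % g)
  shrinkGap {g} (P , Q , wP , wQ , P≡Q+g) {L} wL =
    L + L ℕ./ g * Q , L ℕ./ g * P , wL ++ʷ repeat wQ (L ℕ./ g) , repeat wP (L ℕ./ g) , lengths
    where
    regroup : ∀ a b c e → a + b * c + b * e ≡ b * (e + c) + a
    regroup = solve-∀
    lengths : L + L ℕ./ g * Q ≡ L ℕ./ g * P + L % g
    lengths = begin
      L + L ℕ./ g * Q                      ≡⟨ cong (_+ L ℕ./ g * Q) (m≡m%n+[m/n]*n L g) ⟩
      L % g + L ℕ./ g * g + L ℕ./ g * Q    ≡⟨ regroup (L % g) (L ℕ./ g) g Q ⟩
      L ℕ./ g * (Q + g) + L % g            ≡⟨ cong (λ u → L ℕ./ g * u + L % g) (sym P≡Q+g) ⟩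
      L ℕ./ g * P + L % g                  ∎

  -- Descent on the gap g.  If depth is consistent modulo g, then g is an
  -- admissible period, so g ≤ t ≤ g; otherwise a closed walk of length
  -- L ≢ 0 (mod g) shrinks the gap to L mod g < g.
  gap⇒periodGap : ∀ g .{{_ : NonZero g}} → Gap g → Gap t
  gap⇒periodGap = <-rec (λ g → .{{_ : NonZero g}} → Gap g → Gap t) descend
    where
    descend : ∀ g → (∀ {g′} → g′ < g → .{{_ : NonZero g′}} → Gap g′ → Gap t) →
              .{{_ : NonZero g}} → Gap g → Gap t
    descend g smaller gap@(P , Q , wP , wQ , P≡Q+g) = decide (Residue.consistent? g)
      where
      decide : Dec (Residue.Consistent g) → Gap t
      decide (yes consistent) = subst Gap (≤-antisym g≤t (period≤gap gap)) gap
        where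
        g≤t : g ≤ t
        g≤t = maximal g _ (Residue.consistent⇒partition g consistent wP
                            (subst (g ≤_) (sym P≡Q+g) (m≤n+m g Q)))
      decide (no inconsistent) = shrink (Residue.inconsistent⇒closedWalk g inconsistent)
        where
        shrink : ∃ (λ L → Closed L × ¬ (Mod._≡ₘ_ g L 0)) → Gap t
        shrink (L , wL , L≢0) = smaller (m%n<n L g) {{ℕ.≢-nonZero L%g≢0}} (shrinkGap gap wL)
          where
          L%g≢0 : ¬ (L % g ≡ 0)
          L%g≢0 L%g≡0 = L≢0 (trans L%g≡0 (sym (Mod.zero-residue g)))

  periodGap : Gap t
  periodGap = gap⇒periodGap (suc k) (suc k , 0 , loop , ε , refl)
    where
    k : ℕ
    k = proj₁ (fromPath (irreducible base base))
    loop : Closed (suc k)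
    loop = proj₂ (fromPath (irreducible base base))

  -- With closed walks of lengths q t and (q + 1) t, every multiple m t with
  -- m ≥ q² is a closed-walk length.
  closedMultiples : ∃ λ N → ∀ m → N ≤ m → Closed (m * t)
  closedMultiples = multiples periodGap
    where
    factor : ∀ x y q t → x * (q * t) + y * (q * t + t) ≡ (x * q + y * (1 + q)) * t
    factor = solve-∀
    multiples : Gap t → ∃ λ N → ∀ m → N ≤ m → Closed (m * t)
    multiples (P , Q , wP , wQ , P≡Q+t) = q * q , λ m q²≤m → closedWalk m (consecutive-combination q m q²≤m)
      where
      q : ℕ
      q = Q ℕ./ t
      Q≡qt : Q ≡ q * t
      Q≡qt = ≡ₘ0⇒multiple (closed-≡ₘ0 wQ)
      closedWalk : ∀ m → (∃ λ x → ∃ λ y → x * q + y * suc q ≡ m) → Closed (m * t)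
      closedWalk m (x , y , combination) = subst Closed lengths (repeat wQ x ++ʷ repeat wP y)
        where
        lengths : x * Q + y * P ≡ m * t
        lengths = begin
          x * Q + y * P                      ≡⟨ cong₂ (λ u v → x * u + y * v) Q≡qt
                                                      (trans P≡Q+t (cong (_+ t) Q≡qt)) ⟩
          x * (q * t) + y * (q * t + t)      ≡⟨ factor x y q t ⟩
          (x * q + y * suc q) * t            ≡⟨ cong (_* t) combination ⟩
          m * t                              ∎

  closedWalkOfLength : ∃ λ N → ∀ L → N ≤ L → L ≡ₘ 0 → Closed L
  closedWalkOfLength = N * t , closedWalk
    where
    N : ℕ
    N = proj₁ closedMultiples
    closedWalk : ∀ L → N * t ≤ L → L ≡ₘ 0 → Closed L
    closedWalk L Nt≤L L≡0 = subst Closed (sym L≡[L/t]t) (proj₂ closedMultiples (L ℕ./ t) N≤L/t)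
      where
      L≡[L/t]t : L ≡ L ℕ./ t * t
      L≡[L/t]t = ≡ₘ0⇒multiple L≡0
      N≤L/t : N ≤ L ℕ./ t
      N≤L/t = *-cancelʳ-≤ N (L ℕ./ t) t (subst (N * t ≤_) L≡[L/t]t Nt≤L)

  -- Walks a → b exist for every large length m with p a + m ≡ p b (mod t):
  -- go to the base vertex, wind around it, and continue to b.
  longWalks : ∀ a b → ∃ λ N → ∀ m → N ≤ m → p a + m ≡ₘ p b → Walk a b m
  longWalks a b = α + β + N , walk
    where
    α : ℕ
    α = proj₁ (reach a base)
    toBase : Walk a base α
    toBase = proj₂ (reach a base)
    β : ℕ
    β = proj₁ (reach base b)
    fromBase : Walk base b β
    fromBase = proj₂ (reach base b)
    N : ℕ
    N = proj₁ closedWalkOfLength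
    closed : ∀ L → N ≤ L → L ≡ₘ 0 → Closed L
    closed = proj₂ closedWalkOfLength
    walk : ∀ m → α + β + N ≤ m → p a + m ≡ₘ p b → Walk a b m
    walk m bound a+m≡b = subst (Walk a b) lengths (toBase ++ʷ closed L N≤L L≡0 ++ʷ fromBase)
      where
      L : ℕ
      L = m ∸ (α + β)
      α+β+L≡m : α + β + L ≡ m
      α+β+L≡m = m+[n∸m]≡n (≤-trans (m≤m+n (α + β) N) bound)
      N≤L : N ≤ L
      N≤L = +-cancelˡ-≤ (α + β) N L (subst (α + β + N ≤_) (sym α+β+L≡m) bound)
      a+α≡0 : p a + α ≡ₘ 0
      a+α≡0 = trans (walk-step toBase) (cong (_% t) p-base)
      β≡b : β ≡ₘ p b
      β≡b = subst (λ x → x + β ≡ₘ p b) p-base (walk-step fromBase)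
      reassociate : ∀ x y z w → x + (y + z + w) ≡ (x + y) + (z + w)
      reassociate = solve-∀
      L≡0 : L ≡ₘ 0
      L≡0 = ≡ₘ-cancelˡ (p b) (begin
        (p b + L) % t                 ≡⟨ ≡ₘ-+ʳ L (sym β≡b) ⟩
        (β + L) % t                   ≡⟨ ≡ₘ-+ʳ (β + L) a+α≡0 ⟨
        (p a + α + (β + L)) % t       ≡⟨ cong (_% t) (reassociate (p a) α β L) ⟨
        (p a + (α + β + L)) % t       ≡⟨ cong (λ u → (p a + u) % t) α+β+L≡m ⟩
        (p a + m) % t                 ≡⟨ a+m≡b ⟩
        p b % t                       ≡⟨ cong (_% t) (+-comm 0 (p b)) ⟩
        (p b + 0) % t                 ∎)
      shuffle : ∀ x y z → x + (y + z) ≡ x + z + y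
      shuffle = solve-∀
      lengths : α + (L + β) ≡ m
      lengths = trans (shuffle α L β) α+β+L≡m

  pairedWalks : ∀ {i′ j′ i j} → p j′ + p i ≡ₘ p j + p i′ → ∃ λ m → Walk i′ i m × Walk j′ j m
  pairedWalks {i′} {j′} {i} {j} sameClass =
    m , proj₂ (longWalks i′ i) m (≤-trans (m≤m+n N₁ N₂) N≤m) i′+m≡i ,
        proj₂ (longWalks j′ j) m (≤-trans (m≤n+m N₂ N₁) N≤m) j′+m≡j
    where
    N₁ : ℕ
    N₁ = proj₁ (longWalks i′ i)
    N₂ : ℕ
    N₂ = proj₁ (longWalks j′ j)
    shift : ∃ λ m → N₁ + N₂ ≤ m × p i′ + m ≡ₘ p i
    shift = large-shift (p i) (N₁ + N₂) (<⇒≤ (p<t i′))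
    m : ℕ
    m = proj₁ shift
    N≤m : N₁ + N₂ ≤ m
    N≤m = proj₁ (proj₂ shift)
    i′+m≡i : p i′ + m ≡ₘ p i
    i′+m≡i = proj₂ (proj₂ shift)
    j′+m≡j : p j′ + m ≡ₘ p j
    j′+m≡j = ≡ₘ-cancelʳ (p i′) (begin
      (p j′ + m + p i′) % t     ≡⟨ cong (λ u → u % t) (trans (+-assoc (p j′) m (p i′))
                                                             (cong (p j′ +_) (+-comm m (p i′)))) ⟩
      (p j′ + (p i′ + m)) % t   ≡⟨ ≡ₘ-+ˡ (p j′) i′+m≡i ⟩
      (p j′ + p i) % t          ≡⟨ sameClass ⟩
      (p j + p i′) % t          ∎)

-- The maximum principle for solutions of A X Aᵀ = X with A stochastic

module Harmonic {ℓ : Level} (R : RealField ℓ) where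
  open Matrices R
  open OrderedField R
  open import Data.Product using (proj₁; proj₂)
  open import Data.Sum using (inj₁; inj₂)
  open import Data.Empty using (⊥-elim)
  open import Relation.Binary.PropositionalEquality using (refl; sym; trans; subst)

  module MaximumPrinciple {n : ℕ} {A : Matrix n} (stochastic : Stochastic A) {X : Matrix n}
           (harmonic : ∀ i j → ((A · X) · (A ᵀ)) i j ≡ X i j) where
    open Digraph R A using (Walk; ε; _◅_)

    private
      weight≥0 : ∀ i k → 0ℝ ≼ A i k
      weight≥0 i k = ≤⇒≼ (proj₁ stochastic i k)

    -- (A X Aᵀ) i j averages X k l with weights A i k A j l.  So if X i j
    -- bounds X over all successor pairs (k, l) of (i, j), it is attained
    -- at each of them: otherwise the average would be strictly smaller.
    maximum-principle : ∀ {i j} → (∀ {k l} → Edge A i k → Edge A j l → X k l ≼ X i j) →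
                        ∀ {k l} → Edge A i k → Edge A j l → X k l ≡ X i j
    maximum-principle {i} {j} bound {k₀} {l₀} e₁ e₂ with bound e₁ e₂
    ... | inj₂ attained = attained
    ... | inj₁ below = ⊥-elim (<-irrefl (X i j) (subst (_< X i j) (harmonic i j) average<))
      where
      rowAverage≼ : ∀ l → 0ℝ < A j l → (A · X) i l ≼ X i j
      rowAverage≼ l e = average-≼ (A i) (λ k → X k l) (X i j) (weight≥0 i) (proj₂ stochastic i)
                                  (λ k e′ → bound e′ e)
      rowAverage< : (A · X) i l₀ < X i j
      rowAverage< = average-< (A i) (λ k → X k l₀) (X i j) (weight≥0 i) (proj₂ stochastic i)
                              (λ k e′ → bound e′ e₂) k₀ e₁ below
      average< : ((A · X) · (A ᵀ)) i j < X i j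
      average< = subst (_< X i j) (∑-cong (λ l → *-comm (A j l) ((A · X) i l)))
        (average-< (A j) (λ l → (A · X) i l) (X i j) (weight≥0 j) (proj₂ stochastic j)
                   rowAverage≼ l₀ e₂ rowAverage<)

    module _ {s} (S : Fin n → Fin n → Set s)
             (S-step : ∀ {a b a′ b′} → S a b → Edge A a a′ → Edge A b b′ → S a′ b′) where

      propagate : ∀ {m₁ m₂ x₁ x₂ k} → S m₁ m₂ → (∀ {a b} → S a b → X a b ≼ X m₁ m₂) →
                  Walk m₁ x₁ k → Walk m₂ x₂ k → X x₁ x₂ ≡ X m₁ m₂
      propagate _ _ ε ε = refl
      propagate {m₁} {m₂} inS isMax (_◅_ {b = k} e₁ w₁) (_◅_ {b = l} e₂ w₂) =
        trans (propagate (S-step inS e₁ e₂) (λ {a} {b} inS′ → subst (X a b ≼_) (sym stepValue) (isMax inS′)) w₁ w₂)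
              stepValue
        where
        stepValue : X k l ≡ X m₁ m₂
        stepValue = maximum-principle (λ f₁ f₂ → isMax (S-step inS f₁ f₂)) e₁ e₂

module Expansion {ℓ : Level} (R : RealField ℓ) where
  open Matrices R
  open OrderedField R
  import Data.Nat as ℕ
  open import Data.Fin using (zero; suc)
  open import Data.Fin.Properties using (toℕ-injective)
  open import Data.Empty using (⊥-elim)
  open import Relation.Nullary using (¬_; yes; no)
  open import Relation.Binary.PropositionalEquality using (refl; sym; trans; cong)
  open Relation.Binary.PropositionalEquality.≡-Reasoning

  ∑M-entry : ∀ {n m} (F : Fin m → Matrix n) i j → ∑M F i j ≡ ∑ (λ δ → F δ i j)
  ∑M-entry {m = ℕ.zero}  F i j = refl
  ∑M-entry {m = ℕ.suc m} F i j = cong (F zero i j +_) (∑M-entry (λ δ → F (suc δ)) i j)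

  Xδ-on : ∀ {n} t p δ (i j : Fin n) → dist t p i j ≡ δ → Xδ t p δ i j ≡ 1ℝ
  Xδ-on t p δ i j d≡δ with dist t p i j ℕ.≟ δ
  ... | yes _   = refl
  ... | no d≢δ  = ⊥-elim (d≢δ d≡δ)

  Xδ-off : ∀ {n} t p δ (i j : Fin n) → ¬ (dist t p i j ≡ δ) → Xδ t p δ i j ≡ 0ℝ
  Xδ-off t p δ i j d≢δ with dist t p i j ℕ.≟ δ
  ... | yes d≡δ = ⊥-elim (d≢δ d≡δ)
  ... | no _    = refl

  expansion-entry : ∀ {n K} (c : Fin K → ℝ) t p (i j : Fin n) (δ₀ : Fin K) →
                    toℕ δ₀ ≡ dist t p i j → ∑M (λ δ → c δ ⊙ Xδ t p (toℕ δ)) i j ≡ c δ₀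
  expansion-entry c t p i j δ₀ δ₀≡d = begin
    ∑M (λ δ → c δ ⊙ Xδ t p (toℕ δ)) i j      ≡⟨ ∑M-entry (λ δ → c δ ⊙ Xδ t p (toℕ δ)) i j ⟩
    ∑ (λ δ → c δ * Xδ t p (toℕ δ) i j)        ≡⟨ ∑-single _ δ₀ offDiagonal ⟩
    c δ₀ * Xδ t p (toℕ δ₀) i j                 ≡⟨ cong (c δ₀ *_) (Xδ-on t p (toℕ δ₀) i j (sym δ₀≡d)) ⟩
    c δ₀ * 1ℝ                                  ≡⟨ *-identityʳ (c δ₀) ⟩
    c δ₀                                       ∎
    where
    offDiagonal : ∀ δ → ¬ (δ ≡ δ₀) → c δ * Xδ t p (toℕ δ) i j ≡ 0ℝ
    offDiagonal δ δ≢δ₀ = trans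
      (cong (c δ *_) (Xδ-off t p (toℕ δ) i j (λ d≡δ → δ≢δ₀ (toℕ-injective (trans (sym d≡δ) (sym δ₀≡d))))))
      (*-zeroʳ (c δ))


module Distance {ℓ : Level} (R : RealField ℓ) {n : ℕ} (t : ℕ) .{{_ : Data.Nat.NonZero t}}
                (p : Fin n → ℕ) (p≤t : ∀ i → p i Data.Nat.≤ t) where
  open Matrices R using (dist)
  open Mod t
  open import Data.Nat as ℕ using (_+_; _∸_; _⊓_; _%_; _≤_; ∣_-_∣)
  open import Data.Nat.Properties
    using (≤-total; ≤-trans; +-assoc; m+[n∸m]≡n; m≤n⇒∣m-n∣≡n∸m; m≤n⇒∣n-m∣≡n∸m;
           ∣m-n∣≤m⊔n; ⊔-lub; ⊓-sel; m⊓n≤m; m⊓n≤n; +-mono-≤)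
  open import Data.Nat.DivMod using ([m+n]%n≡m%n; /-monoˡ-≤; m*n/n≡m)
  open import Data.Nat.Tactic.RingSolver using (solve-∀)
  open import Data.Sum using (_⊎_; inj₁; inj₂)
  import Data.Sum as Sum
  open import Relation.Binary.PropositionalEquality using (sym; trans; cong; subst)
  open Relation.Binary.PropositionalEquality.≡-Reasoning

  ∣-∣≤t : ∀ i j → ∣ p i - p j ∣ ≤ t
  ∣-∣≤t i j = ≤-trans (∣m-n∣≤m⊔n (p i) (p j)) (⊔-lub (p≤t i) (p≤t j))

  -- dist(i, j) ≤ ⌊t/2⌋, because 2 min(D, t - D) ≤ D + (t - D) = t.
  dist≤half : ∀ i j → dist t p i j ≤ t ℕ./ 2
  dist≤half i j = subst (_≤ t ℕ./ 2) (m*n/n≡m d 2) (/-monoˡ-≤ 2 2d≤t)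
    where
    D : ℕ
    D = ∣ p i - p j ∣
    d : ℕ
    d = dist t p i j
    double : ∀ x → x + x ≡ x ℕ.* 2
    double = solve-∀
    2d≤t : d ℕ.* 2 ≤ t
    2d≤t = subst (_≤ t) (double d)
      (subst (d + d ≤_) (m+[n∸m]≡n (∣-∣≤t i j)) (+-mono-≤ (m⊓n≤m D (t ∸ D)) (m⊓n≤n D (t ∸ D))))

  shortWay : ∀ {a b D} → a + D ≡ b → D ≤ t → (a + D ⊓ (t ∸ D) ≡ₘ b) ⊎ (b + D ⊓ (t ∸ D) ≡ₘ a)
  shortWay {a} {b} {D} a+D≡b D≤t with ⊓-sel D (t ∸ D)
  ... | inj₁ min≡D   = inj₁ (cong (_% t) (trans (cong (a +_) min≡D) a+D≡b))
  ... | inj₂ min≡t∸D = inj₂ (begin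
    (b + D ⊓ (t ∸ D)) % t    ≡⟨ cong (λ u → (b + u) % t) min≡t∸D ⟩
    (b + (t ∸ D)) % t        ≡⟨ cong (λ u → (u + (t ∸ D)) % t) (sym a+D≡b) ⟩
    (a + D + (t ∸ D)) % t    ≡⟨ cong (_% t) (trans (+-assoc a D (t ∸ D)) (cong (a +_) (m+[n∸m]≡n D≤t))) ⟩
    (a + t) % t              ≡⟨ [m+n]%n≡m%n a t ⟩
    a % t                    ∎)

  dist-residue : ∀ i j → (p j + dist t p i j ≡ₘ p i) ⊎ (p i + dist t p i j ≡ₘ p j)
  dist-residue i j with ≤-total (p i) (p j)
  ... | inj₁ pi≤pj = Sum.swap (shortWay (trans (cong (p i +_) (m≤n⇒∣m-n∣≡n∸m pi≤pj)) (m+[n∸m]≡n pi≤pj))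
                                        (∣-∣≤t i j))
  ... | inj₂ pj≤pi = shortWay (trans (cong (p j +_) (m≤n⇒∣n-m∣≡n∸m pj≤pi)) (m+[n∸m]≡n pj≤pi))
                              (∣-∣≤t i j)

-- X is constant on residue classes of pairs; the theorem

module Theorem {ℓ : Level} (R : RealField ℓ) where
  open Matrices R
    using (ℝ; 0ℝ; _≤_; Matrix; _·_; _ᵀ; _⊙_; ∑M; Edge; Irreducible; Stochastic; PeriodicWith;
           InSym; dist; Xδ)
  open OrderedField R using (_≼_; ≼-totalOrder)
  open Expansion R using (expansion-entry)
  open import Data.Nat as ℕ using (_+_; _%_; _<_; s≤s; z≤n)
  open import Data.Nat.Properties using (+-comm; +-assoc; <⇒≤; ≤-<-trans; ≤-pred)
  open import Data.Nat.DivMod using (m/n<m)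
  open import Data.Nat.Tactic.RingSolver using (solve-∀)
  open import Data.Fin using (fromℕ<)
  open import Data.Fin.Properties using (toℕ<n; toℕ-fromℕ<)
  open import Data.Product using (proj₁; proj₂)
  open import Data.Sum using (_⊎_; inj₁; inj₂)
  open import Data.List using (List; cartesianProduct; allFin; filter)
  open import Data.List.Membership.Propositional.Properties using (∈-cartesianProduct⁺; ∈-allFin; ∈-filter⁺)
  open import Data.List.Relation.Unary.All using (lookup)
  open import Data.List.Relation.Unary.All.Properties using (all-filter)
  open import Data.List.Extrema ≼-totalOrder using (argmax; argmax-all; f[xs]≤f[argmax])
  open import Relation.Nullary using (Dec)
  open import Relation.Binary.PropositionalEquality using (refl; sym; trans; cong)
  open Relation.Binary.PropositionalEquality.≡-Reasoning

  module Classes {n : ℕ} (A : Matrix n) (t : ℕ) (p : Fin n → ℕ)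
                 (irreducible : Irreducible A) (stochastic : Stochastic A) (periodic : PeriodicWith A t p)
                 (X : Matrix n) (symmetric : InSym X) (harmonic : ∀ i j → ((A · X) · (A ᵀ)) i j ≡ X i j)
                 where
    open Periodic R A {t} {p} irreducible periodic using (t≢0; p<t; partition; base; p-base; edge-step; pairedWalks)
    open Harmonic.MaximumPrinciple R {A = A} stochastic {X = X} harmonic using (propagate)
    open Distance R t p (λ i → <⇒≤ (p<t i)) using (dist≤half; dist-residue)
    open Mod t

    -- (a, b) and (c, d) lie in the same class when p b - p a ≡ p d - p c (mod t).
    SameClass : Fin n → Fin n → Fin n → Fin n → Set
    SameClass a b c d = p b + p c ≡ₘ p d + p a

    -- Classes are stable under simultaneous steps along edges, since both
    -- class indices increase by one.
    sameClass-step : ∀ {a b c d a′ b′} → SameClass a b c d → Edge A a a′ → Edge A b b′ →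
                     SameClass a′ b′ c d
    sameClass-step {a} {b} {c} {d} {a′} {b′} same e₁ e₂ = begin
      (p b′ + p c) % t         ≡⟨ ≡ₘ-+ʳ (p c) (edge-step e₂) ⟨
      (p b + 1 + p c) % t      ≡⟨ cong (_% t) (swap (p b) 1 (p c)) ⟩
      (p b + p c + 1) % t      ≡⟨ ≡ₘ-+ʳ 1 same ⟩
      (p d + p a + 1) % t      ≡⟨ cong (_% t) (+-assoc (p d) (p a) 1) ⟩
      (p d + (p a + 1)) % t    ≡⟨ ≡ₘ-+ˡ (p d) (edge-step e₁) ⟩
      (p d + p a′) % t         ∎
      where
      swap : ∀ x y z → x + y + z ≡ x + z + y
      swap = solve-∀

    sameClass-trans : ∀ {a b c d e f} → SameClass a b c d → SameClass c d e f → SameClass a b e f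
    sameClass-trans {a} {b} {c} {d} {e} {f} s₁ s₂ = ≡ₘ-cancelʳ (p c + p d) (begin
      (p b + p e + (p c + p d)) % t       ≡⟨ cong (_% t) (regroup₁ (p b) (p e) (p c) (p d)) ⟩
      (p b + p c + (p d + p e)) % t       ≡⟨ ≡ₘ-+ s₁ s₂ ⟩
      (p d + p a + (p f + p c)) % t       ≡⟨ cong (_% t) (regroup₂ (p d) (p a) (p f) (p c)) ⟩
      (p f + p a + (p c + p d)) % t       ∎)
      where
      regroup₁ : ∀ x y z w → x + y + (z + w) ≡ x + z + (w + y)
      regroup₁ = solve-∀
      regroup₂ : ∀ x y z w → x + y + (z + w) ≡ z + y + (w + x)
      regroup₂ = solve-∀

    -- A maximiser of X over the class of (a, b), found in the finite list
    -- of all index pairs.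
    InClass : Fin n → Fin n → Fin n × Fin n → Set
    InClass a b z = SameClass (proj₁ z) (proj₂ z) a b

    inClass? : ∀ a b z → Dec (InClass a b z)
    inClass? a b z = p (proj₂ z) + p a ≡ₘ? p b + p (proj₁ z)

    value : Fin n × Fin n → ℝ
    value z = X (proj₁ z) (proj₂ z)

    pairs : List (Fin n × Fin n)
    pairs = cartesianProduct (allFin n) (allFin n)

    maximiser : Fin n → Fin n → Fin n × Fin n
    maximiser a b = argmax value (a , b) (filter (inClass? a b) pairs)

    maximiser-inClass : ∀ a b → InClass a b (maximiser a b)
    maximiser-inClass a b = argmax-all value {P = InClass a b} refl (all-filter (inClass? a b) pairs)

    maximiser-max : ∀ a b {c d} → SameClass c d a b → X c d ≼ value (maximiser a b)
    maximiser-max a b {c} {d} same =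
      lookup (f[xs]≤f[argmax] {f = value} (a , b) (filter (inClass? a b) pairs))
             (∈-filter⁺ (inClass? a b) (∈-cartesianProduct⁺ (∈-allFin c) (∈-allFin d)) same)

    -- X is constant on classes: every pair of the class of (a, b) is reached
    -- from the maximiser by paired walks, along which the maximum propagates.
    classConstant : ∀ {a b c d} → SameClass a b c d → X a b ≡ X c d
    classConstant {a} {b} same = trans (atMaximum m-ab) (sym (atMaximum (sameClass-trans m-ab same)))
      where
      m₁ : Fin n
      m₁ = proj₁ (maximiser a b)
      m₂ : Fin n
      m₂ = proj₂ (maximiser a b)
      m-ab : SameClass m₁ m₂ a b
      m-ab = maximiser-inClass a b
      atMaximum : ∀ {x y} → SameClass m₁ m₂ x y → X x y ≡ X m₁ m₂
      atMaximum same′ = propagate (λ x y → SameClass x y a b) sameClass-step m-ab (maximiser-max a b)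
                                  (proj₁ (proj₂ (pairedWalks same′))) (proj₂ (proj₂ (pairedWalks same′)))

    δ<t : (δ : Fin (suc (t / 2))) → toℕ δ < t
    δ<t δ = ≤-<-trans (≤-pred (toℕ<n δ)) (m/n<m t 2 (s≤s (s≤s z≤n)))

    layer : Fin (suc (t / 2)) → Fin n
    layer δ = proj₁ (proj₁ (proj₂ partition) (toℕ δ) (δ<t δ))

    p-layer : ∀ δ → p (layer δ) ≡ toℕ δ
    p-layer δ = proj₂ (proj₁ (proj₂ partition) (toℕ δ) (δ<t δ))

    -- c_δ is the common value of X on pairs at distance δ.
    coefficient : Fin (suc (t / 2)) → ℝ
    coefficient δ = X base (layer δ)

    coefficient≥0 : ∀ δ → 0ℝ ≤ coefficient δ
    coefficient≥0 δ = proj₁ symmetric base (layer δ)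

    entry≡coefficient : ∀ i j δ → toℕ δ ≡ dist t p i j → X i j ≡ coefficient δ
    entry≡coefficient i j δ δ≡d = byResidue (dist-residue i j)
      where
      layer≡d : p (layer δ) ≡ dist t p i j
      layer≡d = trans (p-layer δ) δ≡d
      byResidue : (p j + dist t p i j ≡ₘ p i) ⊎ (p i + dist t p i j ≡ₘ p j) → X i j ≡ coefficient δ
      byResidue (inj₁ j+d≡i) = trans (classConstant same) (proj₂ symmetric (layer δ) base)
        where
        same : SameClass i j (layer δ) base
        same = begin
          (p j + p (layer δ)) % t    ≡⟨ cong (λ u → (p j + u) % t) layer≡d ⟩
          (p j + dist t p i j) % t   ≡⟨ j+d≡i ⟩
          p i % t                    ≡⟨ cong (λ u → (u + p i) % t) p-base ⟨
          (p base + p i) % t         ∎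
      byResidue (inj₂ i+d≡j) = classConstant same
        where
        same : SameClass i j base (layer δ)
        same = begin
          (p j + p base) % t           ≡⟨ cong (λ u → (p j + u) % t) p-base ⟩
          (p j + 0) % t                ≡⟨ cong (_% t) (+-comm (p j) 0) ⟩
          p j % t                      ≡⟨ i+d≡j ⟨
          (p i + dist t p i j) % t     ≡⟨ cong (_% t) (+-comm (p i) (dist t p i j)) ⟩
          (dist t p i j + p i) % t     ≡⟨ cong (λ u → (u + p i) % t) layer≡d ⟨
          (p (layer δ) + p i) % t      ∎

    expansion : ∀ i j → X i j ≡ ∑M (λ δ → coefficient δ ⊙ Xδ t p (toℕ δ)) i j
    expansion i j = trans (entry≡coefficient i j δ δ≡d) (sym (expansion-entry coefficient t p i j δ δ≡d))
      where
      d<K : dist t p i j < suc (t / 2)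
      d<K = s≤s (dist≤half i j)
      δ : Fin (suc (t / 2))
      δ = fromℕ< d<K
      δ≡d : toℕ δ ≡ dist t p i j
      δ≡d = toℕ-fromℕ< d<K

mainTheorem10 : {ℓ : Level} (R : RealField ℓ) → let open Matrices R in
    (n : ℕ) (A : Matrix n) (t : ℕ) (p : Fin n → ℕ) →
    Irreducible A → Stochastic A → PeriodicWith A t p →
    (X : Matrix n) → InSym X → (∀ i j → ((A · X) · (A ᵀ)) i j ≡ X i j) →
    ∃ λ (c : Fin (suc (t / 2)) → ℝ) →
      (∀ δ → 0ℝ ≤ c δ) × (∀ i j → X i j ≡ ∑M (λ δ → c δ ⊙ Xδ t p (toℕ δ)) i j)
mainTheorem10 R n A t p irreducible stochastic periodic X symmetric harmonic =
  coefficient , coefficient≥0 , expansion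
  where
  open Theorem.Classes R A t p irreducible stochastic periodic X symmetric harmonic
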